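{- Let $\mathcal{A}$ be a finite set of nonzero niners in $\mathbb{S}$. Given $p,q\in\mathcal{A}+\mathcal{A}$ and distinct $x,y\in\mathcal{A}^{ -1}\mathcal{A}$, there is at most one quadruple $(a,b,c,d)\in\mathcal{A}^4$ such that $$a+c=p,\quad b+d=q,\quad b^{ -1}a=x,\quad d^{ -1}c=y.$$
   Context: The 16-ons $\mathbb{S}$: the real vector space $\mathbb{O}\times\mathbb{O}\cong\mathbb{R}^{16}$ ($\mathbb{O}$ the octonions with conjugation $\bar\cdot$), with multiplication $(a,b)(c,d)=\left(ac-d\bar b,\; cb+(\bar a b^{ -1})(bd)\right)$ if $b\ne0$ and $(a,0)(c,d)=(ac,\bar a d)$; conjugation $\overline{(a,b)}=(\bar a,-b)$; every nonzero $x$ has inverse $x^{ -1}=\bar x\|x\|^{ -2}$, $\|\cdot\|$ the Euclidean norm on $\mathbb{R}^{16}$. A niner is a 16-on $(x_1,x_2)$ with $x_2\in\mathbb{R}$ (last seven real coordinates zero). $\mathcal{A}+\mathcal{A}=\{a+b:a,b\in\mathcal{A}\}$, $\mathcal{A}^{ -1}\mathcal{A}=\{a^{ -1}b:a,b\in\mathcal{A}\}$. -}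

module Defs where

open import Level using (0ℓ)
open import Data.Product using (_×_; _,_; Σ; ∃; proj₁; proj₂)
open import Data.Product.Properties using (≡-dec)
open import Data.Sum using (_⊎_)
open import Data.Unit using (⊤)
open import Data.List using (List)
open import Data.List.Membership.Propositional using (_∈_)
open import Relation.Nullary using (yes; no; ¬_)
open import Relation.Binary.PropositionalEquality using (_≡_; _≢_)
open import Relation.Binary.Definitions using (DecidableEquality)
open import Relation.Binary.Structures using (IsStrictTotalOrder)
open import Algebra.Structures using (IsCommutativeRing)

-- The multiplicative inverse
-- is a total function, specified only on nonzero elements.
record RealField : Set₁ where
  infixl 6 _+_
  infixl 7 _*_
  infix 4 _<_ _≤_
  field
    ℝ   : Set
    _+_ : ℝ → ℝ → ℝ
    _*_ : ℝ → ℝ → ℝ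
    -_  : ℝ → ℝ
    0ℝ  : ℝ
    1ℝ  : ℝ
    isCommutativeRing : IsCommutativeRing _≡_ _+_ _*_ -_ 0ℝ 1ℝ
    _⁻¹ : ℝ → ℝ
    ⁻¹-inverse : ∀ x → x ≢ 0ℝ → x * (x ⁻¹) ≡ 1ℝ
    0≢1 : 0ℝ ≢ 1ℝ
    _<_ : ℝ → ℝ → Set
    <-isStrictTotalOrder : IsStrictTotalOrder _≡_ _<_
    +-mono-< : ∀ x y z → x < y → x + z < y + z
    *-pos : ∀ x y → 0ℝ < x → 0ℝ < y → 0ℝ < x * y

  _≤_ : ℝ → ℝ → Set
  x ≤ y = x < y ⊎ x ≡ y

  field
    complete : (P : ℝ → Set) → ∃ P → (∃ λ u → ∀ x → P x → x ≤ u) →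
               ∃ λ s → (∀ x → P x → x ≤ s) × (∀ u → (∀ x → P x → x ≤ u) → s ≤ u)

  _≟_ : DecidableEquality ℝ
  _≟_ = IsStrictTotalOrder._≟_ <-isStrictTotalOrder

module Over (Rf : RealField) where
  open RealField Rf

  -- A real *-algebra presented by coordinates, as used in the
  -- Cayley–Dickson construction.
  record Alg : Set₁ where
    field
      Car   : Set
      zero  : Car
      add   : Car → Car → Car
      neg   : Car → Car
      mul   : Car → Car → Car
      conj  : Car → Car
      scale : ℝ → Car → Car
      nsq   : Car → ℝ          -- squared Euclidean norm of the coordinates
      isReal : Car → Set       -- all non-real coordinates vanish
      dec   : DecidableEquality Car

  ℝAlg : Alg
  ℝAlg = record
    { Car = ℝ ; zero = 0ℝ ; add = _+_ ; neg = -_ ; mul = _*_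
    ; conj = λ x → x ; scale = _*_ ; nsq = λ x → x * x
    ; isReal = λ _ → ⊤ ; dec = _≟_ }

  double : Alg → Alg
  double A = record
    { Car = Car × Car
    ; zero = (zero , zero)
    ; add = λ { (a , b) (c , d) → (add a c , add b d) }
    ; neg = λ { (a , b) → (neg a , neg b) }
    ; mul = λ { (a , b) (c , d) →
          (add (mul a c) (neg (mul (conj d) b)) , add (mul d a) (mul b (conj c))) }
    ; conj = λ { (a , b) → (conj a , neg b) }
    ; scale = λ { r (a , b) → (scale r a , scale r b) }
    ; nsq = λ { (a , b) → nsq a + nsq b }
    ; isReal = λ { (a , b) → isReal a × b ≡ zero }
    ; dec = ≡-dec dec dec }
    where open Alg A

  ℂAlg ℍAlg 𝕆Alg : Alg
  ℂAlg = double ℝAlg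
  ℍAlg = double ℂAlg
  𝕆Alg = double ℍAlg

  𝕆 : Set
  𝕆 = Alg.Car 𝕆Alg

  open Alg 𝕆Alg public using ()
    renaming (zero to 0𝕆; add to _+𝕆_; neg to -𝕆_; mul to _·𝕆_;
              conj to conj𝕆; scale to scale𝕆; nsq to nsq𝕆; isReal to isReal𝕆; dec to _≟𝕆_)

  inv𝕆 : 𝕆 → 𝕆
  inv𝕆 b = scale𝕆 (nsq𝕆 b ⁻¹) (conj𝕆 b)

  𝕊 : Set
  𝕊 = 𝕆 × 𝕆

  0𝕊 : 𝕊
  0𝕊 = (0𝕆 , 0𝕆)

  infixl 6 _+𝕊_
  infixl 7 _·𝕊_

  _+𝕊_ : 𝕊 → 𝕊 → 𝕊
  (a , b) +𝕊 (c , d) = (a +𝕆 c , b +𝕆 d)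

  _·𝕊_ : 𝕊 → 𝕊 → 𝕊
  (a , b) ·𝕊 (c , d) with b ≟𝕆 0𝕆
  ... | yes _ = (a ·𝕆 c , conj𝕆 a ·𝕆 d)
  ... | no  _ = ( (a ·𝕆 c) +𝕆 (-𝕆 (d ·𝕆 conj𝕆 b))
                , (c ·𝕆 b) +𝕆 ((conj𝕆 a ·𝕆 inv𝕆 b) ·𝕆 (b ·𝕆 d)) )

  conj𝕊 : 𝕊 → 𝕊
  conj𝕊 (a , b) = (conj𝕆 a , -𝕆 b)

  nsq𝕊 : 𝕊 → ℝ
  nsq𝕊 (a , b) = nsq𝕆 a + nsq𝕆 b

  inv𝕊 : 𝕊 → 𝕊
  inv𝕊 x = (scale𝕆 (nsq𝕊 x ⁻¹) (proj₁ (conj𝕊 x)) , scale𝕆 (nsq𝕊 x ⁻¹) (proj₂ (conj𝕊 x)))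

  Niner : 𝕊 → Set
  Niner (x₁ , x₂) = isReal𝕆 x₂

  _∈SumSet_ : 𝕊 → List 𝕊 → Set
  p ∈SumSet A = Σ 𝕊 λ a → Σ 𝕊 λ b → a ∈ A × b ∈ A × p ≡ a +𝕊 b

  _∈QuotSet_ : 𝕊 → List 𝕊 → Set
  x ∈QuotSet A = Σ 𝕊 λ a → Σ 𝕊 λ b → a ∈ A × b ∈ A × x ≡ inv𝕊 a ·𝕊 b

  Quad : List 𝕊 → 𝕊 → 𝕊 → 𝕊 → 𝕊 → 𝕊 → 𝕊 → 𝕊 → 𝕊 → Set
  Quad A p q x y a b c d =
    (a ∈ A × b ∈ A × c ∈ A × d ∈ A) ×
    (a +𝕊 c ≡ p × b +𝕊 d ≡ q × inv𝕊 b ·𝕊 a ≡ x × inv𝕊 d ·𝕊 c ≡ y)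

{-# OPTIONS --safe #-}

-- For a niner b = (u , t) the 16-on product is z = (c , d) ↦ (uc − td , tc + ūd), which is
-- bilinear in (b , z) and, by alternativity of 𝕆, satisfies b̄(bz) = ‖b‖²z.  So left
-- multiplication by a nonzero niner is injective, b(b⁻¹a) = a, and b⁻¹a = x means a = bx.
-- For two quadruples, (b − b′)(x − y) = ((a + c) − (a′ + c′)) − ((b + d) − (b′ + d′))y = 0,
-- and b − b′ is a niner, so x ≠ y forces b = b′; then d = d′, a = bx = a′ and c = dy = c′.

module Submission where

open import Level using (0ℓ)
open import Function using (_∘_)
open import Data.Empty using (⊥-elim)
open import Data.Integer as ℤ using (ℤ; -[1+_]; _⊖_; sign; ∣_∣; _◃_)
import Data.Integer.Properties as ℤ
open import Data.List using (List)
open import Data.List.Membership.Propositional using (_∈_)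
open import Data.Maybe using (nothing)
open import Data.Nat as ℕ using (ℕ; zero; suc; NonZero)
import Data.Nat.Properties as ℕ
open import Data.Nat.DivMod using (_mod_)
open import Data.Product using (_×_; _,_; proj₁; proj₂)
open import Data.Sign as Sign using (Sign)
open import Data.Sum using (inj₁; inj₂)
open import Data.Vec using (Vec; []; _∷_; _++_)
open import Relation.Binary.Definitions using (tri<; tri≈; tri>)
open import Relation.Binary.Structures using (IsStrictTotalOrder)
open import Relation.Binary.PropositionalEquality as ≡ using (_≡_; _≢_)
open import Relation.Nullary using (yes; no)
open import Algebra.Bundles using (CommutativeRing)
open import Algebra.Structures using (IsCommutativeRing)
open import Tactic.RingSolver.Core.AlmostCommutativeRing
  using (AlmostCommutativeRing; fromCommutativeRing)
open import Tactic.RingSolver.Core.Polynomial.Parameters using (Homomorphism)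
open import Tactic.RingSolver.Core.Expression using (Expr; Κ; Ι; _⊕_; _⊗_; _⊛_; ⊝_; module Eval)

open import Defs

-- Tactic.RingSolver.NonReflective takes the carrier itself as coefficients, so the
-- normal forms of an identity over an abstract ring need not compute.  With integer
-- coefficients they do, and an identity is proved by comparing normal forms with refl.
module IntegerCoefficientSolver {c ℓ} (R : CommutativeRing c ℓ) where

  open CommutativeRing R
  open import Data.Bool using (Bool; true; false; T)
  open import Algebra.Properties.Semiring.Mult semiring using (×-homo-+; ×1-homo-*) renaming (_×_ to _·_)
  open import Algebra.Properties.Semiring.Exp.TCOptimised semiring using (^-congˡ)
  open import Algebra.Properties.Ring ring using (-‿involutive; -0#≈0#; -1*x≈-x)
  open import Algebra.Properties.AbelianGroup +-abelianGroup
    using (xyx⁻¹≈y; ⁻¹-∙-comm; ⁻¹-anti-homo-∙)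
  open import Algebra.Properties.CommutativeSemigroup *-commutativeSemigroup using (interchange)
  open import Relation.Binary.Reasoning.Setoid setoid

  ⟦_⟧ℤ : ℤ → Carrier
  ⟦ ℤ.+ n    ⟧ℤ = n · 1#
  ⟦ -[1+ n ] ⟧ℤ = - (suc n · 1#)

  ⊖-homo : ∀ m n → ⟦ m ⊖ n ⟧ℤ ≈ m · 1# - n · 1#
  ⊖-homo m       zero    = sym (trans (+-congˡ -0#≈0#) (+-identityʳ _))
  ⊖-homo zero    (suc n) = sym (+-identityˡ _)
  ⊖-homo (suc m) (suc n) = begin
    ⟦ suc m ⊖ suc n ⟧ℤ   ≡⟨ ≡.cong ⟦_⟧ℤ (ℤ.[1+m]⊖[1+n]≡m⊖n m n) ⟩
    ⟦ m ⊖ n ⟧ℤ           ≈⟨ ⊖-homo m n ⟩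
    a - b                ≈⟨ xyx⁻¹≈y 1# (a - b) ⟨
    1# + (a - b) - 1#    ≈⟨ +-congʳ (+-assoc 1# a (- b)) ⟨
    1# + a - b - 1#      ≈⟨ +-assoc _ _ _ ⟩
    1# + a + (- b - 1#)  ≈⟨ +-congˡ (⁻¹-anti-homo-∙ 1# b) ⟨
    1# + a - (1# + b)    ∎
    where a = m · 1#; b = n · 1#

  +-homo : ∀ i j → ⟦ i ℤ.+ j ⟧ℤ ≈ ⟦ i ⟧ℤ + ⟦ j ⟧ℤ
  +-homo -[1+ m ] -[1+ n ] = begin
    - (suc (suc (m ℕ.+ n)) · 1#)     ≡⟨ ≡.cong (λ k → - (suc k · 1#)) (ℕ.+-suc m n) ⟨
    - ((suc m ℕ.+ suc n) · 1#)       ≈⟨ -‿cong (×-homo-+ 1# (suc m) (suc n)) ⟩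
    - (suc m · 1# + suc n · 1#)      ≈⟨ ⁻¹-∙-comm _ _ ⟨
    - (suc m · 1#) - suc n · 1#      ∎
  +-homo -[1+ m ] (ℤ.+ n) = trans (⊖-homo n (suc m)) (+-comm _ _)
  +-homo (ℤ.+ m) -[1+ n ] = ⊖-homo m (suc n)
  +-homo (ℤ.+ m) (ℤ.+ n)  = ×-homo-+ 1# m n

  -‿homo : ∀ i → ⟦ ℤ.- i ⟧ℤ ≈ - ⟦ i ⟧ℤ
  -‿homo (ℤ.+ zero)  = sym -0#≈0#
  -‿homo (ℤ.+ suc n) = refl
  -‿homo -[1+ n ]    = sym (-‿involutive _)

  ⟦_⟧ₛ : Sign → Carrier
  ⟦ Sign.+ ⟧ₛ = 1#
  ⟦ Sign.- ⟧ₛ = - 1#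

  sign-homo : ∀ s t → ⟦ s Sign.* t ⟧ₛ ≈ ⟦ s ⟧ₛ * ⟦ t ⟧ₛ
  sign-homo Sign.+ t      = sym (*-identityˡ _)
  sign-homo Sign.- Sign.+ = sym (*-identityʳ _)
  sign-homo Sign.- Sign.- = sym (trans (-1*x≈-x (- 1#)) (-‿involutive 1#))

  ◃-homo : ∀ s n → ⟦ s ◃ n ⟧ℤ ≈ ⟦ s ⟧ₛ * (n · 1#)
  ◃-homo s      zero    = sym (zeroʳ _)
  ◃-homo Sign.+ (suc n) = sym (*-identityˡ _)
  ◃-homo Sign.- (suc n) = sym (-1*x≈-x _)

  sign-abs-homo : ∀ i → ⟦ i ⟧ℤ ≈ ⟦ sign i ⟧ₛ * (∣ i ∣ · 1#)
  sign-abs-homo i = trans (reflexive (≡.cong ⟦_⟧ℤ (≡.sym (ℤ.◃-inverse i)))) (◃-homo (sign i) ∣ i ∣)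

  *-homo : ∀ i j → ⟦ i ℤ.* j ⟧ℤ ≈ ⟦ i ⟧ℤ * ⟦ j ⟧ℤ
  *-homo i j = begin
    ⟦ sign i Sign.* sign j ◃ ∣ i ∣ ℕ.* ∣ j ∣ ⟧ℤ
      ≈⟨ ◃-homo (sign i Sign.* sign j) (∣ i ∣ ℕ.* ∣ j ∣) ⟩
    ⟦ sign i Sign.* sign j ⟧ₛ * ((∣ i ∣ ℕ.* ∣ j ∣) · 1#)
      ≈⟨ *-cong (sign-homo (sign i) (sign j)) (×1-homo-* ∣ i ∣ ∣ j ∣) ⟩
    ⟦ sign i ⟧ₛ * ⟦ sign j ⟧ₛ * ((∣ i ∣ · 1#) * (∣ j ∣ · 1#))
      ≈⟨ interchange _ _ _ _ ⟩
    ⟦ sign i ⟧ₛ * (∣ i ∣ · 1#) * (⟦ sign j ⟧ₛ * (∣ j ∣ · 1#))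
      ≈⟨ *-cong (sign-abs-homo i) (sign-abs-homo j) ⟨
    ⟦ i ⟧ℤ * ⟦ j ⟧ℤ ∎

  almostCommutativeRing : AlmostCommutativeRing c ℓ
  almostCommutativeRing = fromCommutativeRing R (λ _ → nothing)

  isZero : ℤ → Bool
  isZero (ℤ.+ zero) = true
  isZero _          = false

  isZero-homo : ∀ i → T (isZero i) → 0# ≈ ⟦ i ⟧ℤ
  isZero-homo (ℤ.+ zero) _ = refl

  homomorphism : Homomorphism 0ℓ 0ℓ c ℓ
  homomorphism = record
    { from          = record { rawRing = ℤ.+-*-rawRing ; isZero = isZero }
    ; to            = almostCommutativeRing
    ; morphism      = record
      { ⟦_⟧ = ⟦_⟧ℤ ; +-homo = +-homo ; *-homo = *-homo ; -‿homo = -‿homo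
      ; 0-homo = refl ; 1-homo = +-identityʳ 1# }
    ; Zero-C⟶Zero-R = isZero-homo
    }

  open Eval rawRing ⟦_⟧ℤ public
  open import Tactic.RingSolver.Core.Polynomial.Base (Homomorphism.from homomorphism)
    using (Poly; κ; ι; _⊞_; _⊠_; ⊟_; _⊡_)
  open import Tactic.RingSolver.Core.Polynomial.Semantics homomorphism
    using () renaming (⟦_⟧ to ⟦_⟧ₚ)
  open import Tactic.RingSolver.Core.Polynomial.Homomorphism homomorphism
    using (κ-hom; ι-hom; ⊞-hom; ⊠-hom; ⊟-hom; ⊡-hom)

  normalise : ∀ {n} → Expr ℤ n → Poly n
  normalise (Κ x)   = κ x
  normalise (Ι x)   = ι x
  normalise (x ⊕ y) = normalise x ⊞ normalise y
  normalise (x ⊗ y) = normalise x ⊠ normalise y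
  normalise (⊝ x)   = ⊟ normalise x
  normalise (x ⊛ i) = normalise x ⊡ i

  ⟦_⇓⟧ : ∀ {n} → Expr ℤ n → Vec Carrier n → Carrier
  ⟦ e ⇓⟧ = ⟦ normalise e ⟧ₚ

  correct : ∀ {n} (e : Expr ℤ n) ρ → ⟦ e ⇓⟧ ρ ≈ ⟦ e ⟧ ρ
  correct (Κ x)   ρ = κ-hom x ρ
  correct (Ι x)   ρ = ι-hom x ρ
  correct (x ⊕ y) ρ = trans (⊞-hom (normalise x) (normalise y) ρ) (+-cong (correct x ρ) (correct y ρ))
  correct (x ⊗ y) ρ = trans (⊠-hom (normalise x) (normalise y) ρ) (*-cong (correct x ρ) (correct y ρ))
  correct (⊝ x)   ρ = trans (⊟-hom (normalise x) ρ) (-‿cong (correct x ρ))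
  correct (x ⊛ i) ρ = trans (⊡-hom (normalise x) i ρ) (^-congˡ i (correct x ρ))

-- 𝕆 and 𝕊 are, definitionally, Doubled 3 ℝ and Doubled 4 ℝ.

Doubled : ℕ → Set → Set
Doubled zero    A = A
Doubled (suc k) A = Doubled k A × Doubled k A

dim : ℕ → ℕ
dim zero    = 1
dim (suc k) = dim k ℕ.+ dim k

coordinates : ∀ {A} k → Doubled k A → Vec A (dim k)
coordinates zero    x       = x ∷ []
coordinates (suc k) (x , y) = coordinates k x ++ coordinates k y

mapᴰ : ∀ {A B : Set} k → (A → B) → Doubled k A → Doubled k B
mapᴰ zero    f x       = f x
mapᴰ (suc k) f (x , y) = mapᴰ k f x , mapᴰ k f y

mapᴰ-cong : ∀ {A B : Set} k {f g : A → B} → (∀ x → f x ≡ g x) → ∀ x → mapᴰ k f x ≡ mapᴰ k g x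
mapᴰ-cong zero    f≗g x       = f≗g x
mapᴰ-cong (suc k) f≗g (x , y) = ≡.cong₂ _,_ (mapᴰ-cong k f≗g x) (mapᴰ-cong k f≗g y)

record StarOps (A : Set) : Set where
  field
    add mul   : A → A → A
    neg conj  : A → A

-- The formulas of Over.double, for an arbitrary carrier.
cayleyDickson : ∀ {A} → StarOps A → StarOps (A × A)
cayleyDickson O = record
  { add  = λ { (a , b) (c , d) → add a c , add b d }
  ; mul  = λ { (a , b) (c , d) → add (mul a c) (neg (mul (conj d) b)) , add (mul d a) (mul b (conj c)) }
  ; neg  = λ { (a , b) → neg a , neg b }
  ; conj = λ { (a , b) → conj a , neg b }
  }
  where open StarOps O

-- The operations of Over, on 16-ons whose coordinates are polynomials in n variables.
-- Evaluated in ρ they reduce to the corresponding operations of Over, so an identity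
-- between 16-ons is proved by `solve` with both sides written in this vocabulary.
module Symbolic {A : Set} {_+_ _*_ : A → A → A} { -_ : A → A} {0# 1# : A}
  (isCommutativeRing : IsCommutativeRing _≡_ _+_ _*_ -_ 0# 1#)
  {n} .{{_ : NonZero n}} (ρ : Vec A n) where

  commutativeRing : CommutativeRing 0ℓ 0ℓ
  commutativeRing = record { isCommutativeRing = isCommutativeRing }

  open IntegerCoefficientSolver commutativeRing using (⟦_⟧; ⟦_⇓⟧; correct)

  P : Set
  P = Expr ℤ n

  Term𝕆 Term𝕊 : Set
  Term𝕆 = Doubled 3 P
  Term𝕊 = Doubled 4 P

  variables : ∀ k → ℕ → Doubled k P
  variables zero    i = Ι (i mod n)
  variables (suc k) i = variables k i , variables k (i ℕ.+ dim k)

  solve : ∀ k (L M : Doubled k P) →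
          mapᴰ k (λ p → ⟦ p ⇓⟧ ρ) L ≡ mapᴰ k (λ p → ⟦ p ⇓⟧ ρ) M →
          mapᴰ k (λ p → ⟦ p ⟧ ρ) L ≡ mapᴰ k (λ p → ⟦ p ⟧ ρ) M
  solve k L M L≡M = begin
    mapᴰ k (λ p → ⟦ p ⟧ ρ) L   ≡⟨ mapᴰ-cong k (λ p → correct p ρ) L ⟨
    mapᴰ k (λ p → ⟦ p ⇓⟧ ρ) L  ≡⟨ L≡M ⟩
    mapᴰ k (λ p → ⟦ p ⇓⟧ ρ) M  ≡⟨ mapᴰ-cong k (λ p → correct p ρ) M ⟩
    mapᴰ k (λ p → ⟦ p ⟧ ρ) M   ∎
    where open ≡.≡-Reasoning

  0ℝ : P
  0ℝ = Κ (ℤ.+ 0)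

  ops : ∀ k → StarOps (Doubled k P)
  ops zero    = record { add = _⊕_ ; mul = _⊗_ ; neg = ⊝_ ; conj = λ x → x }
  ops (suc k) = cayleyDickson (ops k)

  open StarOps (ops 3) public using () renaming
    (add to _+𝕆_; mul to _·𝕆_; neg to -𝕆_; conj to conj𝕆)
  open StarOps (ops 4) public using () renaming
    (add to _+𝕊_; neg to -𝕊_)

  scale : ∀ k → P → Doubled k P → Doubled k P
  scale k r = mapᴰ k (r ⊗_)

  nsq : ∀ k → Doubled k P → P
  nsq zero    x       = x ⊗ x
  nsq (suc k) (x , y) = nsq k x ⊕ nsq k y

  _-_ : P → P → P
  x - y = x ⊕ ⊝ y

  _-𝕆_ : Term𝕆 → Term𝕆 → Term𝕆
  x -𝕆 y = x +𝕆 (-𝕆 y)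

  _-𝕊_ : Term𝕊 → Term𝕊 → Term𝕊
  x -𝕊 y = x +𝕊 (-𝕊 y)

  real : P → Term𝕆
  real t = ((t , 0ℝ) , (0ℝ , 0ℝ)) , ((0ℝ , 0ℝ) , (0ℝ , 0ℝ))

  mulNiner : Term𝕆 → P → Term𝕊 → Term𝕊
  mulNiner u t (c , d) = (u ·𝕆 c) -𝕆 scale 3 t d , scale 3 t c +𝕆 (conj𝕆 u ·𝕆 d)

module EuclideanCoordinates (Rf : RealField) where

  open RealField Rf
  open Over Rf public
  open ≡ using (refl; sym; trans; cong; cong₂; subst; subst₂)

  ℝ-commutativeRing : CommutativeRing 0ℓ 0ℓ
  ℝ-commutativeRing = record { isCommutativeRing = isCommutativeRing }

  open CommutativeRing ℝ-commutativeRing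
    using (ring; +-group; +-identityˡ; +-identityʳ; +-comm; -‿inverseʳ; *-identityˡ; *-identityʳ;
           *-assoc; *-comm; zeroˡ)
  open import Algebra.Properties.Ring ring using (-‿involutive; -‿distribˡ-*; -‿distribʳ-*)
  open import Algebra.Properties.Group +-group using (x∙y⁻¹≈ε⇒x≈y; ∙-cancelˡ)
  module ℝ< = IsStrictTotalOrder <-isStrictTotalOrder
  open ≡.≡-Reasoning

  infixl 6 _-_
  _-_ : ℝ → ℝ → ℝ
  x - y = x + - y

  x*y≡0⇒x≡0 : ∀ {x y} → y ≢ 0ℝ → x * y ≡ 0ℝ → x ≡ 0ℝ
  x*y≡0⇒x≡0 {x} {y} y≢0 xy≡0 = begin
    x                ≡⟨ *-identityʳ x ⟨
    x * 1ℝ           ≡⟨ cong (x *_) (⁻¹-inverse y y≢0) ⟨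
    x * (y * y ⁻¹)   ≡⟨ *-assoc x y (y ⁻¹) ⟨
    x * y * y ⁻¹     ≡⟨ cong (_* y ⁻¹) xy≡0 ⟩
    0ℝ * y ⁻¹        ≡⟨ zeroˡ _ ⟩
    0ℝ               ∎

  x*x≡0⇒x≡0 : ∀ {x} → x * x ≡ 0ℝ → x ≡ 0ℝ
  x*x≡0⇒x≡0 {x} xx≡0 with x ≟ 0ℝ
  ... | yes x≡0 = x≡0
  ... | no  x≢0 = x*y≡0⇒x≡0 x≢0 xx≡0

  x<0⇒0<-x : ∀ {x} → x < 0ℝ → 0ℝ < - x
  x<0⇒0<-x {x} x<0 = subst₂ _<_ (-‿inverseʳ x) (+-identityˡ (- x)) (+-mono-< x 0ℝ (- x) x<0)

  -x*-x≡x*x : ∀ x → - x * - x ≡ x * x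
  -x*-x≡x*x x = begin
    - x * - x    ≡⟨ -‿distribˡ-* x (- x) ⟨
    - (x * - x)  ≡⟨ cong -_ (-‿distribʳ-* x x) ⟨
    - - (x * x)  ≡⟨ -‿involutive _ ⟩
    x * x        ∎

  0≤x*x : ∀ x → 0ℝ ≤ x * x
  0≤x*x x with ℝ<.compare x 0ℝ
  ... | tri< x<0 _ _ = inj₁ (subst (0ℝ <_) (-x*-x≡x*x x) (*-pos _ _ (x<0⇒0<-x x<0) (x<0⇒0<-x x<0)))
  ... | tri≈ _ x≡0 _ = inj₂ (sym (trans (cong (_* x) x≡0) (zeroˡ x)))
  ... | tri> _ _ 0<x = inj₁ (*-pos x x 0<x 0<x)

  0<x+y : ∀ {x y} → 0ℝ < x → 0ℝ ≤ y → 0ℝ < x + y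
  0<x+y {x} 0<x (inj₂ refl) = subst (0ℝ <_) (sym (+-identityʳ x)) 0<x
  0<x+y {x} {y} 0<x (inj₁ 0<y) =
    ℝ<.trans (subst (0ℝ <_) (sym (+-identityˡ y)) 0<y) (+-mono-< 0ℝ x y 0<x)

  0≤x+y : ∀ {x y} → 0ℝ ≤ x → 0ℝ ≤ y → 0ℝ ≤ x + y
  0≤x+y (inj₁ 0<x)          0≤y = inj₁ (0<x+y 0<x 0≤y)
  0≤x+y {y = y} (inj₂ refl) 0≤y = subst (0ℝ ≤_) (sym (+-identityˡ y)) 0≤y

  x+y≡0⇒x≡0 : ∀ {x y} → 0ℝ ≤ x → 0ℝ ≤ y → x + y ≡ 0ℝ → x ≡ 0ℝ
  x+y≡0⇒x≡0 (inj₁ 0<x) 0≤y x+y≡0 = ⊥-elim (ℝ<.irrefl refl (subst (0ℝ <_) x+y≡0 (0<x+y 0<x 0≤y)))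
  x+y≡0⇒x≡0 (inj₂ 0≡x) _   _     = sym 0≡x

  x+y≡0⇒y≡0 : ∀ {x y} → 0ℝ ≤ x → 0ℝ ≤ y → x + y ≡ 0ℝ → y ≡ 0ℝ
  x+y≡0⇒y≡0 {x} {y} 0≤x 0≤y x+y≡0 = x+y≡0⇒x≡0 0≤y 0≤x (trans (+-comm y x) x+y≡0)

  record CoordinateLaws (A : Alg) : Set where
    open Alg A renaming (zero to 0ᴬ)
    field
      0≤nsq           : ∀ a → 0ℝ ≤ nsq a
      nsq≡0⇒≡0       : ∀ a → nsq a ≡ 0ℝ → a ≡ 0ᴬ
      scale-identityˡ : ∀ a → scale 1ℝ a ≡ a
      scale≡0⇒≡0      : ∀ k a → a ≢ 0ᴬ → scale k a ≡ 0ᴬ → k ≡ 0ℝ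
      x-y≡0⇒x≡y       : ∀ a b → add a (neg b) ≡ 0ᴬ → a ≡ b
      +-cancelˡ       : ∀ a b c → add a b ≡ add a c → b ≡ c

    nsq⁻¹*nsq≡1 : ∀ a → a ≢ 0ᴬ → nsq a ⁻¹ * nsq a ≡ 1ℝ
    nsq⁻¹*nsq≡1 a a≢0 = trans (*-comm _ _) (⁻¹-inverse (nsq a) (a≢0 ∘ nsq≡0⇒≡0 a))

  open CoordinateLaws public

  ℝ-laws : CoordinateLaws ℝAlg
  ℝ-laws = record
    { 0≤nsq           = 0≤x*x
    ; nsq≡0⇒≡0       = λ _ → x*x≡0⇒x≡0
    ; scale-identityˡ = *-identityˡ
    ; scale≡0⇒≡0      = λ _ _ → x*y≡0⇒x≡0
    ; x-y≡0⇒x≡y       = x∙y⁻¹≈ε⇒x≈y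
    ; +-cancelˡ       = ∙-cancelˡ
    }

  double-laws : ∀ {A} → CoordinateLaws A → CoordinateLaws (double A)
  double-laws {A} L = record
    { 0≤nsq           = λ (a , b) → 0≤x+y (0≤nsq L a) (0≤nsq L b)
    ; nsq≡0⇒≡0       = λ (a , b) ‖ab‖≡0 → cong₂ _,_
        (nsq≡0⇒≡0 L a (x+y≡0⇒x≡0 (0≤nsq L a) (0≤nsq L b) ‖ab‖≡0))
        (nsq≡0⇒≡0 L b (x+y≡0⇒y≡0 (0≤nsq L a) (0≤nsq L b) ‖ab‖≡0))
    ; scale-identityˡ = λ (a , b) → cong₂ _,_ (scale-identityˡ L a) (scale-identityˡ L b)
    ; scale≡0⇒≡0      = scale≡0⇒≡0′
    ; x-y≡0⇒x≡y       = λ (a , b) (c , d) e →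
        cong₂ _,_ (x-y≡0⇒x≡y L a c (cong proj₁ e)) (x-y≡0⇒x≡y L b d (cong proj₂ e))
    ; +-cancelˡ       = λ (a , b) (c , d) (e , f) eq →
        cong₂ _,_ (+-cancelˡ L a c e (cong proj₁ eq)) (+-cancelˡ L b d f (cong proj₂ eq))
    }
    where
    open Alg A using (scale; dec) renaming (zero to 0ᴬ)

    scale≡0⇒≡0′ : ∀ k ab → ab ≢ (0ᴬ , 0ᴬ) → (scale k (proj₁ ab) , scale k (proj₂ ab)) ≡ (0ᴬ , 0ᴬ) → k ≡ 0ℝ
    scale≡0⇒≡0′ k (a , b) ab≢0 e with dec a 0ᴬ | dec b 0ᴬ
    ... | no a≢0  | _        = scale≡0⇒≡0 L k a a≢0 (cong proj₁ e)
    ... | yes _   | no b≢0   = scale≡0⇒≡0 L k b b≢0 (cong proj₂ e)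
    ... | yes a≡0 | yes b≡0  = ⊥-elim (ab≢0 (cong₂ _,_ a≡0 b≡0))

  𝕆-laws : CoordinateLaws 𝕆Alg
  𝕆-laws = double-laws (double-laws (double-laws ℝ-laws))

  -- 𝕊 as a Euclidean space; the multiplication of this Alg is not that of the 16-ons.
  𝕊Alg : Alg
  𝕊Alg = double 𝕆Alg

  𝕊-laws : CoordinateLaws 𝕊Alg
  𝕊-laws = double-laws 𝕆-laws

module Niners (Rf : RealField) where

  open RealField Rf
  open EuclideanCoordinates Rf public
  open ≡ using (refl; sym; trans; cong; cong₂; subst)
  open ≡.≡-Reasoning

  open Alg 𝕊Alg public using () renaming (neg to -𝕊_; scale to scale𝕊)

  _-𝕆_ : 𝕆 → 𝕆 → 𝕆
  x -𝕆 y = x +𝕆 (-𝕆 y)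

  _-𝕊_ : 𝕊 → 𝕊 → 𝕊
  x -𝕊 y = x +𝕊 (-𝕊 y)

  real : ℝ → 𝕆
  real t = ((t , 0ℝ) , (0ℝ , 0ℝ)) , ((0ℝ , 0ℝ) , (0ℝ , 0ℝ))

  -- Matching a proof of Niner (u , b₂) against this pattern forces b₂ = real t.
  pattern real-coordinates = ((_ , refl) , refl) , refl

  -- Left multiplication by the niner (u , real t); both cases of _·𝕊_ reduce to it.
  mulNiner : 𝕆 → ℝ → 𝕊 → 𝕊
  mulNiner u t (c , d) = (u ·𝕆 c) -𝕆 scale𝕆 t d , scale𝕆 t c +𝕆 (conj𝕆 u ·𝕆 d)

  module S = Symbolic isCommutativeRing

  mulNiner-0ℝ : ∀ u z → (u ·𝕆 proj₁ z , conj𝕆 u ·𝕆 proj₂ z) ≡ mulNiner u 0ℝ z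
  mulNiner-0ℝ u z = P.solve 4
    (U P.·𝕆 C , P.conj𝕆 U P.·𝕆 D) (P.mulNiner U P.0ℝ (C , D)) refl
    where
    module P = S (coordinates 3 u ++ coordinates 4 z)
    U C D : P.Term𝕆
    U = P.variables 3 0; C = P.variables 3 8; D = P.variables 3 16

  -- The second clause of _·𝕊_ at b = real t, with s standing for ‖b‖⁻².
  product-formula : ∀ u t s c d →
    ( (u ·𝕆 c) +𝕆 (-𝕆 (d ·𝕆 conj𝕆 (real t)))
    , (c ·𝕆 real t) +𝕆 ((conj𝕆 u ·𝕆 scale𝕆 s (conj𝕆 (real t))) ·𝕆 (real t ·𝕆 d)) )
    ≡ ((u ·𝕆 c) -𝕆 scale𝕆 t d , scale𝕆 t c +𝕆 scale𝕆 (s * nsq𝕆 (real t)) (conj𝕆 u ·𝕆 d))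
  product-formula u t s c d = P.solve 4
    ( (U P.·𝕆 C) P.+𝕆 (P.-𝕆 (D P.·𝕆 P.conj𝕆 (P.real T)))
    , (C P.·𝕆 P.real T) P.+𝕆 ((P.conj𝕆 U P.·𝕆 P.scale 3 K (P.conj𝕆 (P.real T))) P.·𝕆 (P.real T P.·𝕆 D)) )
    ( (U P.·𝕆 C) P.-𝕆 P.scale 3 T D
    , P.scale 3 T C P.+𝕆 P.scale 3 (K ⊗ P.nsq 3 (P.real T)) (P.conj𝕆 U P.·𝕆 D) )
    refl
    where
    module P = S (coordinates 3 u ++ t ∷ s ∷ coordinates 3 c ++ coordinates 3 d)
    U C D : P.Term𝕆
    U = P.variables 3 0; C = P.variables 3 10; D = P.variables 3 18
    T K : P.P
    T = P.variables 0 8; K = P.variables 0 9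

  niner-· : ∀ u t z → (u , real t) ·𝕊 z ≡ mulNiner u t z
  niner-· u t z with real t ≟𝕆 0𝕆
  ... | yes t≡0 = subst (λ r → _ ≡ mulNiner u r z) (sym (cong (proj₁ ∘ proj₁ ∘ proj₁) t≡0)) (mulNiner-0ℝ u z)
  ... | no  t≢0 = trans (product-formula u t (nsq𝕆 (real t) ⁻¹) c d)
    (cong (λ w → (u ·𝕆 c) -𝕆 scale𝕆 t d , scale𝕆 t c +𝕆 w)
      (trans (cong (λ k → scale𝕆 k (conj𝕆 u ·𝕆 d)) (nsq⁻¹*nsq≡1 𝕆-laws (real t) t≢0))
             (scale-identityˡ 𝕆-laws (conj𝕆 u ·𝕆 d))))
    where
    c d : 𝕆
    c = proj₁ z; d = proj₂ z

  scale-neg-real : ∀ s t → scale𝕆 s (-𝕆 real t) ≡ real (s * - t)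
  scale-neg-real s t = P.solve 3 (P.scale 3 K (P.-𝕆 P.real T)) (P.real (K ⊗ ⊝ T)) refl
    where
    module P = S (s ∷ t ∷ [])
    K T : P.P
    K = P.variables 0 0; T = P.variables 0 1

  mulNiner-inverse : ∀ u t s w →
    mulNiner u t (mulNiner (scale𝕆 s (conj𝕆 u)) (s * - t) w) ≡ scale𝕊 (s * nsq𝕊 (u , real t)) w
  mulNiner-inverse u t s w = P.solve 4
    (P.mulNiner U T (P.mulNiner (P.scale 3 K (P.conj𝕆 U)) (K ⊗ ⊝ T) W))
    (P.scale 4 (K ⊗ P.nsq 4 (U , P.real T)) W)
    refl
    where
    module P = S (coordinates 3 u ++ t ∷ s ∷ coordinates 4 w)
    U : P.Term𝕆
    U = P.variables 3 0
    T K : P.P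
    T = P.variables 0 8; K = P.variables 0 9
    W : P.Term𝕊
    W = P.variables 4 10

  -- The alternative law ū(uc) = |u|²c of the octonions is what makes this hold.
  mulNiner-conj : ∀ u t w → mulNiner (conj𝕆 u) (- t) (mulNiner u t w) ≡ scale𝕊 (nsq𝕊 (u , real t)) w
  mulNiner-conj u t w = P.solve 4
    (P.mulNiner (P.conj𝕆 U) (⊝ T) (P.mulNiner U T W))
    (P.scale 4 (P.nsq 4 (U , P.real T)) W)
    refl
    where
    module P = S (coordinates 3 u ++ t ∷ coordinates 4 w)
    U : P.Term𝕆
    U = P.variables 3 0
    T : P.P
    T = P.variables 0 8
    W : P.Term𝕊
    W = P.variables 4 9

  mulNiner-zeroʳ : ∀ u t → mulNiner u t 0𝕊 ≡ 0𝕊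
  mulNiner-zeroʳ u t = P.solve 4 (P.mulNiner U T (O , O)) (O , O) refl
    where
    module P = S (coordinates 3 u ++ t ∷ [])
    U O : P.Term𝕆
    U = P.variables 3 0; O = P.real P.0ℝ
    T : P.P
    T = P.variables 0 8

  mulNiner-bilinear : ∀ u w u′ w′ t r t′ r′ x y →
    mulNiner (u -𝕆 u′) (t - t′) (x -𝕊 y) ≡
    ((mulNiner u t x +𝕊 mulNiner w r y) -𝕊 (mulNiner u′ t′ x +𝕊 mulNiner w′ r′ y))
      -𝕊 mulNiner ((u +𝕆 w) -𝕆 (u′ +𝕆 w′)) ((t + r) - (t′ + r′)) y
  mulNiner-bilinear u w u′ w′ t r t′ r′ x y = P.solve 4
    (P.mulNiner (U P.-𝕆 U′) (T P.- T′) (X P.-𝕊 Y))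
    (((P.mulNiner U T X P.+𝕊 P.mulNiner W R Y) P.-𝕊 (P.mulNiner U′ T′ X P.+𝕊 P.mulNiner W′ R′ Y))
      P.-𝕊 P.mulNiner ((U P.+𝕆 W) P.-𝕆 (U′ P.+𝕆 W′)) ((T ⊕ R) P.- (T′ ⊕ R′)) Y)
    refl
    where
    module P = S (coordinates 3 u ++ coordinates 3 w ++ coordinates 3 u′ ++ coordinates 3 w′ ++
                  t ∷ r ∷ t′ ∷ r′ ∷ coordinates 4 x ++ coordinates 4 y)
    U W U′ W′ : P.Term𝕆
    U = P.variables 3 0; W = P.variables 3 8; U′ = P.variables 3 16; W′ = P.variables 3 24
    T R T′ R′ : P.P
    T = P.variables 0 32; R = P.variables 0 33; T′ = P.variables 0 34; R′ = P.variables 0 35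
    X Y : P.Term𝕊
    X = P.variables 4 36; Y = P.variables 4 52

  self-difference-vanishes : ∀ z v r y → (z -𝕊 z) -𝕊 mulNiner (v -𝕆 v) (r - r) y ≡ 0𝕊
  self-difference-vanishes z v r y = P.solve 4
    ((Z P.-𝕊 Z) P.-𝕊 P.mulNiner (V P.-𝕆 V) (R P.- R) Y) (O , O) refl
    where
    module P = S (coordinates 4 z ++ coordinates 3 v ++ r ∷ coordinates 4 y)
    Z Y : P.Term𝕊
    Z = P.variables 4 0; Y = P.variables 4 25
    V O : P.Term𝕆
    V = P.variables 3 16; O = P.real P.0ℝ
    R : P.P
    R = P.variables 0 24

  inverse-niner : ∀ u t →
    inv𝕊 (u , real t) ≡ (scale𝕆 (nsq𝕊 (u , real t) ⁻¹) (conj𝕆 u) , real (nsq𝕊 (u , real t) ⁻¹ * - t))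
  inverse-niner u t = cong (scale𝕆 s (conj𝕆 u) ,_) (scale-neg-real s t)
    where
    s : ℝ
    s = nsq𝕊 (u , real t) ⁻¹

  niner-cancel : ∀ u t a → (u , real t) ≢ 0𝕊 → (u , real t) ·𝕊 (inv𝕊 (u , real t) ·𝕊 a) ≡ a
  niner-cancel u t a b≢0 = begin
    b ·𝕊 (inv𝕊 b ·𝕊 a)
      ≡⟨ niner-· u t (inv𝕊 b ·𝕊 a) ⟩
    mulNiner u t (inv𝕊 b ·𝕊 a)
      ≡⟨ cong (mulNiner u t) (trans (cong (_·𝕊 a) (inverse-niner u t)) (niner-· (scale𝕆 s (conj𝕆 u)) (s * - t) a)) ⟩
    mulNiner u t (mulNiner (scale𝕆 s (conj𝕆 u)) (s * - t) a)
      ≡⟨ mulNiner-inverse u t s a ⟩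
    scale𝕊 (s * nsq𝕊 b) a
      ≡⟨ cong (λ k → scale𝕊 k a) (nsq⁻¹*nsq≡1 𝕊-laws b b≢0) ⟩
    scale𝕊 1ℝ a
      ≡⟨ scale-identityˡ 𝕊-laws a ⟩
    a ∎
    where
    b : 𝕊
    b = u , real t
    s : ℝ
    s = nsq𝕊 b ⁻¹

  niner-quotient : ∀ {b a x} → Niner b → b ≢ 0𝕊 → inv𝕊 b ·𝕊 a ≡ x → a ≡ b ·𝕊 x
  niner-quotient {u , (((t , _) , _) , _)} {a} real-coordinates b≢0 b⁻¹a≡x =
    trans (sym (niner-cancel u t a b≢0)) (cong ((u , real t) ·𝕊_) b⁻¹a≡x)

  mulNiner-nondegenerate : ∀ u t w → w ≢ 0𝕊 → mulNiner u t w ≡ 0𝕊 → (u , real t) ≡ 0𝕊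
  mulNiner-nondegenerate u t w w≢0 uw≡0 = nsq≡0⇒≡0 𝕊-laws _ (scale≡0⇒≡0 𝕊-laws _ w w≢0 (begin
    scale𝕊 (nsq𝕊 (u , real t)) w                ≡⟨ mulNiner-conj u t w ⟨
    mulNiner (conj𝕆 u) (- t) (mulNiner u t w)   ≡⟨ cong (mulNiner (conj𝕆 u) (- t)) uw≡0 ⟩
    mulNiner (conj𝕆 u) (- t) 0𝕊                 ≡⟨ mulNiner-zeroʳ (conj𝕆 u) (- t) ⟩
    0𝕊                                          ∎))

  mulNiner-difference-vanishes : ∀ {u w u′ w′ t r t′ r′ x y} →
    mulNiner u t x +𝕊 mulNiner w r y ≡ mulNiner u′ t′ x +𝕊 mulNiner w′ r′ y →
    u +𝕆 w ≡ u′ +𝕆 w′ → t + r ≡ t′ + r′ →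
    mulNiner (u -𝕆 u′) (t - t′) (x -𝕊 y) ≡ 0𝕊
  mulNiner-difference-vanishes {u} {w} {u′} {w′} {t} {r} {t′} {r′} {x} {y} S≡S′ B≡B′ T≡T′ = begin
    mulNiner (u -𝕆 u′) (t - t′) (x -𝕊 y)
      ≡⟨ mulNiner-bilinear u w u′ w′ t r t′ r′ x y ⟩
    (S -𝕊 S′) -𝕊 mulNiner ((u +𝕆 w) -𝕆 B′) ((t + r) - T′) y
      ≡⟨ cong₂ (λ s v → (s -𝕊 S′) -𝕊 mulNiner (proj₁ v -𝕆 B′) (proj₂ v - T′) y) S≡S′ (cong₂ _,_ B≡B′ T≡T′) ⟩
    (S′ -𝕊 S′) -𝕊 mulNiner (B′ -𝕆 B′) (T′ - T′) y
      ≡⟨ self-difference-vanishes S′ B′ T′ y ⟩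
    0𝕊 ∎
    where
    S S′ : 𝕊
    S  = mulNiner u t x +𝕊 mulNiner w r y
    S′ = mulNiner u′ t′ x +𝕊 mulNiner w′ r′ y
    B′ : 𝕆
    B′ = u′ +𝕆 w′
    T′ : ℝ
    T′ = t′ + r′

  niner-pair-unique : ∀ {b d b′ d′ x y} → Niner b → Niner d → Niner b′ → Niner d′ → x ≢ y →
    b ·𝕊 x +𝕊 d ·𝕊 y ≡ b′ ·𝕊 x +𝕊 d′ ·𝕊 y → b +𝕊 d ≡ b′ +𝕊 d′ → b ≡ b′
  niner-pair-unique
    {u , (((t , _) , _) , _)} {w , (((r , _) , _) , _)} {u′ , (((t′ , _) , _) , _)} {w′ , (((r′ , _) , _) , _)}
    {x} {y} real-coordinates real-coordinates real-coordinates real-coordinates x≢y bx+dy≡b′x+d′y b+d≡b′+d′ =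
    cong₂ (λ v s → v , real s)
      (x-y≡0⇒x≡y 𝕆-laws u u′ (cong proj₁ b-b′≡0))
      (x-y≡0⇒x≡y ℝ-laws t t′ (cong (proj₁ ∘ proj₁ ∘ proj₁ ∘ proj₂) b-b′≡0))
    where
    b-b′≡0 : (u -𝕆 u′ , real (t - t′)) ≡ 0𝕊
    b-b′≡0 = mulNiner-nondegenerate _ _ (x -𝕊 y) (x≢y ∘ x-y≡0⇒x≡y 𝕊-laws x y)
      (mulNiner-difference-vanishes
        (trans (sym (cong₂ _+𝕊_ (niner-· u t x) (niner-· w r y)))
          (trans bx+dy≡b′x+d′y (cong₂ _+𝕊_ (niner-· u′ t′ x) (niner-· w′ r′ y))))
        (cong proj₁ b+d≡b′+d′)
        (cong (proj₁ ∘ proj₁ ∘ proj₁ ∘ proj₂) b+d≡b′+d′))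

lemma6 : (Rf : RealField) → let open Over Rf in
         (A : List 𝕊) → (∀ a → a ∈ A → Niner a × a ≢ 0𝕊) →
         (p q x y : 𝕊) → p ∈SumSet A → q ∈SumSet A →
         x ∈QuotSet A → y ∈QuotSet A → x ≢ y →
         ∀ a b c d a′ b′ c′ d′ →
         Quad A p q x y a b c d → Quad A p q x y a′ b′ c′ d′ →
         a ≡ a′ × b ≡ b′ × c ≡ c′ × d ≡ d′
lemma6 Rf A niners p q x y _ _ _ _ x≢y a b c d a′ b′ c′ d′
  ((_ , b∈A , _ , d∈A) , a+c≡p , b+d≡q , b⁻¹a≡x , d⁻¹c≡y)
  ((_ , b′∈A , _ , d′∈A) , a′+c′≡p , b′+d′≡q , b′⁻¹a′≡x , d′⁻¹c′≡y) =
  a≡a′ , b≡b′ , c≡c′ , d≡d′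
  where
  open Niners Rf
  open ≡ using (sym; trans; cong; cong₂)
  open ≡.≡-Reasoning

  niner : ∀ {e} → e ∈ A → Niner e
  niner e∈A = proj₁ (niners _ e∈A)

  quotient : ∀ {e f z} → e ∈ A → inv𝕊 e ·𝕊 f ≡ z → f ≡ e ·𝕊 z
  quotient e∈A = niner-quotient (niner e∈A) (proj₂ (niners _ e∈A))

  bx+dy≡b′x+d′y : b ·𝕊 x +𝕊 d ·𝕊 y ≡ b′ ·𝕊 x +𝕊 d′ ·𝕊 y
  bx+dy≡b′x+d′y = begin
    b ·𝕊 x +𝕊 d ·𝕊 y    ≡⟨ cong₂ _+𝕊_ (quotient b∈A b⁻¹a≡x) (quotient d∈A d⁻¹c≡y) ⟨
    a +𝕊 c              ≡⟨ trans a+c≡p (sym a′+c′≡p) ⟩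
    a′ +𝕊 c′            ≡⟨ cong₂ _+𝕊_ (quotient b′∈A b′⁻¹a′≡x) (quotient d′∈A d′⁻¹c′≡y) ⟩
    b′ ·𝕊 x +𝕊 d′ ·𝕊 y  ∎

  b≡b′ : b ≡ b′
  b≡b′ = niner-pair-unique (niner b∈A) (niner d∈A) (niner b′∈A) (niner d′∈A) x≢y
    bx+dy≡b′x+d′y (trans b+d≡q (sym b′+d′≡q))

  d≡d′ : d ≡ d′
  d≡d′ = +-cancelˡ 𝕊-laws b d d′ (trans b+d≡q (trans (sym b′+d′≡q) (cong (_+𝕊 d′) (sym b≡b′))))

  a≡a′ : a ≡ a′
  a≡a′ = trans (quotient b∈A b⁻¹a≡x) (trans (cong (_·𝕊 x) b≡b′) (sym (quotient b′∈A b′⁻¹a′≡x)))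

  c≡c′ : c ≡ c′
  c≡c′ = trans (quotient d∈A d⁻¹c≡y) (trans (cong (_·𝕊 y) d≡d′) (sym (quotient d′∈A d′⁻¹c′≡y)))
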